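{- Let $n\ge 3$ and let $(C_n,\mathbf{w})$ be a cycle with positive integer edge weights $w_1,\dots,w_n$ satisfying the triangle inequality (each edge weight is at most the sum of the other edge weights, i.e. every edge is a shortest path between its endpoints). Then $c(C_n,\mathbf{w})=\left\lceil \frac{\sum_{i=1}^{n} w_i}{2}\right\rceil$.
   Context: $d_\mathbf{w}(u,v)$ is the minimum total weight of a $(u,v)$-path. A binary addressing of length $m$ is a map $f:V\to\{0,1\}^m$ with $d_\mathbf{w}(u,v)\le d_H(f(u),f(v))$ for all vertices $u,v$ ($d_H$ the Hamming distance); $c(G,\mathbf{w})$ is the minimum length of a binary addressing. -}

module Defs where

open import Data.Nat using (ℕ; zero; suc; _+_; _≤_)
open import Data.Nat.DivMod using (_mod_)
open import Data.Fin using (Fin; toℕ)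
open import Data.Bool using (Bool; true; false)
open import Data.Vec using (Vec; lookup)
open import Data.List using (List; []; _∷_; map; allFin)
open import Data.Nat.ListAction using (sum)
open import Data.List.Relation.Unary.Unique.Propositional using (Unique)
open import Data.Product using (Σ; _×_)
open import Relation.Nullary using (¬_)
open import Relation.Binary.PropositionalEquality using (_≡_)

-- Cycle C_n: vertices Fin n, edge i (i : Fin n) joins vertex i and vertex (i+1 mod n);
-- edge i has weight w i.
next : {n : ℕ} → Fin n → Fin n
next {suc m} i = suc (toℕ i) mod (suc m)

data Step {n : ℕ} : Fin n → Fin n → Fin n → Set where
  fwd : (e : Fin n) → Step e e (next e)
  bwd : (e : Fin n) → Step e (next e) e

data Walk {n : ℕ} : Fin n → Fin n → Set where
  nil  : {u : Fin n} → Walk u u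
  cons : {u v t : Fin n} (e : Fin n) → Step e u v → Walk v t → Walk u t

weight : {n : ℕ} → (Fin n → ℕ) → {u v : Fin n} → Walk u v → ℕ
weight w nil = 0
weight w (cons e _ p) = w e + weight w p

vertices : {n : ℕ} {u v : Fin n} → Walk u v → List (Fin n)
vertices {u = u} nil = u ∷ []
vertices {u = u} (cons e _ p) = u ∷ vertices p

IsPath : {n : ℕ} {u v : Fin n} → Walk u v → Set
IsPath p = Unique (vertices p)

IsDist : {n : ℕ} → (Fin n → ℕ) → Fin n → Fin n → ℕ → Set
IsDist w u v d =
  Σ (Walk u v) (λ p → IsPath p × weight w p ≡ d)
  × ((p : Walk u v) → IsPath p → d ≤ weight w p)

hamming : {m : ℕ} → Vec Bool m → Vec Bool m → ℕ
hamming {m} x y = sum (map (λ j → diff (lookup x j) (lookup y j)) (allFin m))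
  where
    diff : Bool → Bool → ℕ
    diff true false = 1
    diff false true = 1
    diff _ _ = 0

IsAddressing : {n : ℕ} → (Fin n → ℕ) → (m : ℕ) → (Fin n → Vec Bool m) → Set
IsAddressing {n} w m f = (u v : Fin n) → (d : ℕ) → IsDist w u v d → d ≤ hamming (f u) (f v)

IsMinAddressingLength : {n : ℕ} → (Fin n → ℕ) → ℕ → Set
IsMinAddressingLength w c =
  Σ (Fin _ → Vec Bool c) (IsAddressing w c)
  × ((m : ℕ) → (f : Fin _ → Vec Bool m) → IsAddressing w m f → c ≤ m)

totalWeight : {n : ℕ} → (Fin n → ℕ) → ℕ
totalWeight {n} w = sum (map w (allFin n))

{-# OPTIONS --safe #-}

-- Place each vertex at its clockwise offset from vertex 0 on a circle of circumference W, the total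
-- weight. Then d_w(u, v) is the circular distance of the offsets: both arcs between u and v are
-- paths, and along a walk the circular distance to a fixed point changes by at most the weight of
-- each edge.
-- Upper bound: with K = ⌈W/2⌉, give a point x the K bits [x ∈ (j, j + K]], j < K. Moving x one step
-- rotates these bits and negates the one that wraps around, so this embeds the circle of
-- circumference 2K ≥ W isometrically into the K-cube.
-- Lower bound: by the triangle inequality, vertices 0, x, y can be chosen that cut the cycle into
-- three arcs of length at most W/2, so d(0,x) + d(x,y) + d(y,0) = W; but the pairwise Hamming
-- distances of any three words of length M sum to at most 2M.

module Submission where

open import Defs
open import Data.Bool using (Bool; true; false; not; _∧_)
open import Data.Bool.Properties using (∧-identityʳ; ∧-zeroʳ)
open import Data.Nat
open import Data.Nat.Properties
open import Data.Nat.DivMod using (_mod_; m%n<n; m<n⇒m%n≡m; %-distribˡ-+; m%n%n≡m%n; m≤n⇒[n∸m]%m≡n%m; [m+n]%n≡m%n; n%n≡0)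
open import Data.Nat.ListAction using (sum)
open import Data.Nat.Solver using (module +-*-Solver)
open import Data.Fin using (Fin; toℕ; fromℕ; fromℕ<) renaming (zero to fzero; suc to fsuc)
open import Data.Fin.Properties using (toℕ-injective; toℕ-fromℕ<; toℕ-fromℕ; toℕ<n)
open import Data.List using (_∷_; map; allFin; tabulate; drop; reverse; reverseAcc)
open import Data.List.Properties using (map-tabulate)
open import Data.List.Relation.Unary.All using (All; []; _∷_)
open import Data.List.Relation.Unary.AllPairs using ([]; _∷_)
open import Data.List.Relation.Unary.Unique.Propositional using (Unique)
open import Data.List.Relation.Binary.Permutation.Propositional using (↭-sym; ↭⇒↭ₛ)
open import Data.List.Relation.Binary.Permutation.Propositional.Properties using (↭-reverse)
import Data.List.Relation.Binary.Permutation.Setoid.Properties as Permutationₛ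
open import Data.Vec using (Vec; []; _∷_)
import Data.Vec as Vec
open import Data.Product using (Σ; _×_; _,_; ∃-syntax; proj₁; proj₂)
open import Data.Sum using (_⊎_; inj₁; inj₂)
open import Function using (id; _∘_)
open import Relation.Nullary using (yes; no)
open import Relation.Binary.Definitions using (tri<; tri≈; tri>)
open import Relation.Binary.PropositionalEquality

mismatch : Bool → Bool → ℕ
mismatch true  false = 1
mismatch false true  = 1
mismatch _     _     = 0

mismatch-comm : ∀ a b → mismatch a b ≡ mismatch b a
mismatch-comm true  true  = refl
mismatch-comm true  false = refl
mismatch-comm false true  = refl
mismatch-comm false false = refl

mismatch-not : ∀ a b → mismatch (not a) (not b) ≡ mismatch a b
mismatch-not true  true  = refl
mismatch-not true  false = refl
mismatch-not false true  = refl
mismatch-not false false = refl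

mismatch-cycle : ∀ a b c → mismatch a b + mismatch b c + mismatch c a ≤ 2
mismatch-cycle true  true  true  = z≤n
mismatch-cycle true  true  false = ≤-refl
mismatch-cycle true  false true  = ≤-refl
mismatch-cycle true  false false = ≤-refl
mismatch-cycle false true  true  = ≤-refl
mismatch-cycle false true  false = ≤-refl
mismatch-cycle false false true  = ≤-refl
mismatch-cycle false false false = z≤n

map-tabulate-suc : ∀ {m} (f : Fin (suc m) → ℕ) → map f (tabulate fsuc) ≡ map (f ∘ fsuc) (allFin m)
map-tabulate-suc f = trans (map-tabulate fsuc f) (sym (map-tabulate id (f ∘ fsuc)))

-- Defs.hamming compares bits with a local function that only computes on constructors.
hamming-∷ : ∀ {m} a b (x y : Vec Bool m) → hamming (a ∷ x) (b ∷ y) ≡ mismatch a b + hamming x y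
hamming-∷ {m} true  true  x y = cong sum (map-tabulate-suc {m} _)
hamming-∷ {m} true  false x y = cong (1 +_) (cong sum (map-tabulate-suc {m} _))
hamming-∷ {m} false true  x y = cong (1 +_) (cong sum (map-tabulate-suc {m} _))
hamming-∷ {m} false false x y = cong sum (map-tabulate-suc {m} _)

hamming-comm : ∀ {m} (x y : Vec Bool m) → hamming x y ≡ hamming y x
hamming-comm []      []      = refl
hamming-comm (a ∷ x) (b ∷ y) = begin
  hamming (a ∷ x) (b ∷ y)   ≡⟨ hamming-∷ a b x y ⟩
  mismatch a b + hamming x y ≡⟨ cong₂ _+_ (mismatch-comm a b) (hamming-comm x y) ⟩
  mismatch b a + hamming y x ≡⟨ hamming-∷ b a y x ⟨
  hamming (b ∷ y) (a ∷ x)   ∎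
  where open ≡-Reasoning

hamming-cycle : ∀ {m} (x y z : Vec Bool m) → hamming x y + hamming y z + hamming z x ≤ m + m
hamming-cycle []      []      []      = z≤n
hamming-cycle {suc m} (a ∷ x) (b ∷ y) (c ∷ z) = begin
  hamming (a ∷ x) (b ∷ y) + hamming (b ∷ y) (c ∷ z) + hamming (c ∷ z) (a ∷ x)
    ≡⟨ cong₂ _+_ (cong₂ _+_ (hamming-∷ a b x y) (hamming-∷ b c y z)) (hamming-∷ c a z x) ⟩
  (mismatch a b + hamming x y) + (mismatch b c + hamming y z) + (mismatch c a + hamming z x)
    ≡⟨ regroup (mismatch a b) (mismatch b c) (mismatch c a) (hamming x y) (hamming y z) (hamming z x) ⟩
  (mismatch a b + mismatch b c + mismatch c a) + (hamming x y + hamming y z + hamming z x)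
    ≤⟨ +-mono-≤ (mismatch-cycle a b c) (hamming-cycle x y z) ⟩
  2 + (m + m)
    ≡⟨ cong suc (+-suc m m) ⟨
  suc m + suc m ∎
  where
  open ≤-Reasoning
  open +-*-Solver
  regroup : ∀ a b c d e f → (a + d) + (b + e) + (c + f) ≡ (a + b + c) + (d + e + f)
  regroup = solve 6 (λ a b c d e f → (a :+ d) :+ (b :+ e) :+ (c :+ f) := (a :+ b :+ c) :+ (d :+ e :+ f)) refl

sumTo : ℕ → (ℕ → ℕ) → ℕ
sumTo zero    g = 0
sumTo (suc k) g = sumTo k g + g k

sumTo-head : ∀ k g → sumTo (suc k) g ≡ g 0 + sumTo k (g ∘ suc)
sumTo-head zero    g = +-comm 0 (g 0)
sumTo-head (suc k) g = trans (cong (_+ g (suc k)) (sumTo-head k g)) (+-assoc (g 0) _ _)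

sumTo-cong : ∀ k {f g} → (∀ j → j < k → f j ≡ g j) → sumTo k f ≡ sumTo k g
sumTo-cong zero    eq = refl
sumTo-cong (suc k) eq = cong₂ _+_ (sumTo-cong k (λ j j<k → eq j (m<n⇒m<1+n j<k))) (eq k ≤-refl)

sumTo-mono : ∀ g {k l} → k ≤ l → sumTo k g ≤ sumTo l g
sumTo-mono g {l = zero}  z≤n = z≤n
sumTo-mono g {l = suc l} k≤1+l with m≤n⇒m<n∨m≡n k≤1+l
... | inj₁ k<1+l = ≤-trans (sumTo-mono g (s≤s⁻¹ k<1+l)) (m≤m+n (sumTo l g) (g l))
... | inj₂ refl  = ≤-refl

sumTo-ones : ∀ k {g} → (∀ j → j < k → g j ≡ 1) → sumTo k g ≡ k
sumTo-ones zero    ones = refl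
sumTo-ones (suc k) ones = trans (cong₂ _+_ (sumTo-ones k (λ j j<k → ones j (m<n⇒m<1+n j<k))) (ones k ≤-refl)) (+-comm k 1)

sum-allFin : ∀ k (f : Fin k → ℕ) (g : ℕ → ℕ) → (∀ i → f i ≡ g (toℕ i)) → sum (map f (allFin k)) ≡ sumTo k g
sum-allFin zero    f g eq = refl
sum-allFin (suc k) f g eq = begin
  sum (map f (allFin (suc k)))                ≡⟨ cong (f fzero +_) (cong sum (map-tabulate-suc f)) ⟩
  f fzero + sum (map (f ∘ fsuc) (allFin k))   ≡⟨ cong₂ _+_ (eq fzero) (sum-allFin k (f ∘ fsuc) (g ∘ suc) (eq ∘ fsuc)) ⟩
  g 0 + sumTo k (g ∘ suc)                     ≡⟨ sumTo-head k g ⟨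
  sumTo (suc k) g                             ∎
  where open ≡-Reasoning

<ᵇ-true : ∀ {m n} → m < n → (m <ᵇ n) ≡ true
<ᵇ-true {zero}  (s≤s _) = refl
<ᵇ-true {suc m} (s≤s m<n) = <ᵇ-true m<n

<ᵇ-false : ∀ {m n} → n ≤ m → (m <ᵇ n) ≡ false
<ᵇ-false z≤n       = refl
<ᵇ-false (s≤s n≤m) = <ᵇ-false n≤m

<ᵇ-flip : ∀ m n → (m <ᵇ n) ≡ not (n <ᵇ suc m)
<ᵇ-flip zero    zero    = refl
<ᵇ-flip zero    (suc n) = refl
<ᵇ-flip (suc m) zero    = refl
<ᵇ-flip (suc m) (suc n) = <ᵇ-flip m n

m%n≢[m+o]%n : ∀ n .{{_ : NonZero n}} m {o} → 0 < o → o < n → m % n ≢ (m + o) % n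
m%n≢[m+o]%n n m {o} 0<o o<n m%n≡[m+o]%n = window (m%n<n m n) m%n≡[m%n+o]%n
  where
  m%n≡[m%n+o]%n : m % n ≡ (m % n + o) % n
  m%n≡[m%n+o]%n = trans m%n≡[m+o]%n (trans (%-distribˡ-+ m o n) (cong (λ x → (m % n + x) % n) (m<n⇒m%n≡m o<n)))
  window : ∀ {r} → r < n → r ≢ (r + o) % n
  window {r} r<n r≡[r+o]%n with r + o <? n
  ... | yes r+o<n = <⇒≢ (m<m+n r 0<o) (trans r≡[r+o]%n (m<n⇒m%n≡m r+o<n))
  ... | no  r+o≮n = <⇒≢ r+o∸n<r (sym (trans r≡[r+o]%n [r+o]%n≡r+o∸n))
    where
    n≤r+o : n ≤ r + o
    n≤r+o = ≮⇒≥ r+o≮n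
    r+o∸n<r : r + o ∸ n < r
    r+o∸n<r = subst (r + o ∸ n <_) (m+n∸n≡m r n) (∸-monoˡ-< (+-monoʳ-< r o<n) n≤r+o)
    [r+o]%n≡r+o∸n : (r + o) % n ≡ r + o ∸ n
    [r+o]%n≡r+o∸n = trans (sym (m≤n⇒[n∸m]%m≡n%m n≤r+o)) (m<n⇒m%n≡m (<-≤-trans r+o∸n<r (<⇒≤ r<n)))

m+o∸n≡o∸[n∸m] : ∀ {m n} o → m ≤ n → m + o ∸ n ≡ o ∸ (n ∸ m)
m+o∸n≡o∸[n∸m] {m} {n} o m≤n =
  trans (cong (m + o ∸_) (sym (m+[n∸m]≡n m≤n))) ([m+n]∸[m+o]≡n∸o m o (n ∸ m))

m∸n+m∸n≤m : ∀ {m n} → n ≤ m → m ≤ n + n → (m ∸ n) + (m ∸ n) ≤ m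
m∸n+m∸n≤m {m} {n} n≤m m≤n+n = ≤-trans (+-monoʳ-≤ (m ∸ n) (m≤n+o⇒m∸n≤o m n m≤n+n)) (≤-reflexive (m∸n+n≡m n≤m))

threshold-crossing : ∀ (f : ℕ → ℕ) {t} m → f 0 ≤ t → f m ≤ t ⊎ ∃[ b ] b < m × f b ≤ t × t < f (suc b)
threshold-crossing f zero    f0≤t = inj₁ f0≤t
threshold-crossing f {t} (suc m) f0≤t with threshold-crossing f m f0≤t
... | inj₂ (b , b<m , fb≤t , t<f[1+b]) = inj₂ (b , m<n⇒m<1+n b<m , fb≤t , t<f[1+b])
... | inj₁ fm≤t with f (suc m) ≤? t
...   | yes f[1+m]≤t = inj₁ f[1+m]≤t
...   | no  f[1+m]≰t = inj₂ (m , ≤-refl , fm≤t , ≰⇒> f[1+m]≰t)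

-- Circular distance

circDist : ℕ → ℕ → ℕ → ℕ
circDist L s t = ∣ s - t ∣ ⊓ (L ∸ ∣ s - t ∣)

circDist-comm : ∀ L s t → circDist L s t ≡ circDist L t s
circDist-comm L s t = cong (λ d → d ⊓ (L ∸ d)) (∣-∣-comm s t)

circDist-refl : ∀ L s → circDist L s s ≡ 0
circDist-refl L s = cong (λ d → d ⊓ (L ∸ d)) (∣n-n∣≡0 s)

circDist-monoˡ : ∀ {L L'} s t → L ≤ L' → circDist L s t ≤ circDist L' s t
circDist-monoˡ s t L≤L' = ⊓-monoʳ-≤ ∣ s - t ∣ (∸-monoˡ-≤ ∣ s - t ∣ L≤L')

circDist-≤ : ∀ L {s t} → s ≤ t → circDist L s t ≡ (t ∸ s) ⊓ (L ∸ (t ∸ s))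
circDist-≤ L s≤t = cong (λ d → d ⊓ (L ∸ d)) (m≤n⇒∣m-n∣≡n∸m s≤t)

circDist-short : ∀ L {s t} → s ≤ t → (t ∸ s) + (t ∸ s) ≤ L → circDist L s t ≡ t ∸ s
circDist-short L {s} {t} s≤t short = trans (circDist-≤ L s≤t) (m≤n⇒m⊓n≡m (m+n≤o⇒m≤o∸n (t ∸ s) short))

circDist-end : ∀ L {t} → t ≤ L → circDist L L t ≡ circDist L 0 t
circDist-end L {t} t≤L = begin
  ∣ L - t ∣ ⊓ (L ∸ ∣ L - t ∣) ≡⟨ cong (λ d → d ⊓ (L ∸ d)) (m≤n⇒∣n-m∣≡n∸m t≤L) ⟩
  (L ∸ t) ⊓ (L ∸ (L ∸ t))     ≡⟨ cong ((L ∸ t) ⊓_) (m∸[m∸n]≡n t≤L) ⟩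
  (L ∸ t) ⊓ t                 ≡⟨ ⊓-comm (L ∸ t) t ⟩
  t ⊓ (L ∸ t)                 ∎
  where open ≡-Reasoning

circDist-lipschitz : ∀ L s s' t → circDist L s t ≤ ∣ s - s' ∣ + circDist L s' t
circDist-lipschitz L s s' t = begin
  a ⊓ (L ∸ a)                 ≤⟨ ⊓-mono-≤ a≤e+a' (m≤n+o⇒m∸n≤o L a L≤a+[e+L∸a']) ⟩
  (e + a') ⊓ (e + (L ∸ a'))   ≡⟨ +-distribˡ-⊓ e a' (L ∸ a') ⟨
  e + a' ⊓ (L ∸ a')           ∎
  where
  open ≤-Reasoning
  a a' e : ℕ
  a = ∣ s - t ∣
  a' = ∣ s' - t ∣
  e = ∣ s - s' ∣
  a≤e+a' : a ≤ e + a'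
  a≤e+a' = ∣-∣-triangle s s' t
  L≤a+[e+L∸a'] : L ≤ a + (e + (L ∸ a'))
  L≤a+[e+L∸a'] = begin
    L                  ≤⟨ m≤n+m∸n L a' ⟩
    a' + (L ∸ a')      ≤⟨ +-monoˡ-≤ (L ∸ a') (subst (λ d → a' ≤ d + a) (∣-∣-comm s' s) (∣-∣-triangle s' s t)) ⟩
    e + a + (L ∸ a')   ≡⟨ cong (_+ (L ∸ a')) (+-comm e a) ⟩
    a + e + (L ∸ a')   ≡⟨ +-assoc a e (L ∸ a') ⟩
    a + (e + (L ∸ a')) ∎

-- The circle of circumference 2K in the K-cube

inArc : ℕ → ℕ → ℕ → Bool
inArc K x j = (j <ᵇ x) ∧ (x <ᵇ suc j + K)

arcCode : (K x : ℕ) → Vec Bool K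
arcCode K x = Vec.tabulate (inArc K x ∘ toℕ)

codeDist : ℕ → ℕ → ℕ → ℕ
codeDist K s t = sumTo K (λ j → mismatch (inArc K s j) (inArc K t j))

hamming-tabulate : ∀ k (p q : ℕ → Bool) →
  hamming (Vec.tabulate {n = k} (p ∘ toℕ)) (Vec.tabulate (q ∘ toℕ)) ≡ sumTo k (λ j → mismatch (p j) (q j))
hamming-tabulate zero    p q = refl
hamming-tabulate (suc k) p q = begin
  hamming (Vec.tabulate {n = suc k} (p ∘ toℕ)) (Vec.tabulate (q ∘ toℕ))
    ≡⟨ hamming-∷ {k} (p 0) (q 0) _ _ ⟩
  mismatch (p 0) (q 0) + hamming (Vec.tabulate {n = k} (p ∘ suc ∘ toℕ)) (Vec.tabulate (q ∘ suc ∘ toℕ))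
    ≡⟨ cong (mismatch (p 0) (q 0) +_) (hamming-tabulate k (p ∘ suc) (q ∘ suc)) ⟩
  mismatch (p 0) (q 0) + sumTo k (λ j → mismatch (p (suc j)) (q (suc j)))
    ≡⟨ sumTo-head k _ ⟨
  sumTo (suc k) (λ j → mismatch (p j) (q j)) ∎
  where open ≡-Reasoning

hamming-arcCode : ∀ K s t → hamming (arcCode K s) (arcCode K t) ≡ codeDist K s t
hamming-arcCode K s t = hamming-tabulate K (inArc K s) (inArc K t)

codeDist-comm : ∀ K s t → codeDist K s t ≡ codeDist K t s
codeDist-comm K s t = sumTo-cong K (λ j _ → mismatch-comm (inArc K s j) (inArc K t j))

codeDist-suc : ∀ K .{{_ : NonZero K}} {s t} → s < K + K → t < K + K → codeDist K (suc s) (suc t) ≡ codeDist K s t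
codeDist-suc K@(suc k) {s} {t} s<2K t<2K = begin
  codeDist K (suc s) (suc t)                         ≡⟨ sumTo-head k _ ⟩
  mismatch (s <ᵇ K) (t <ᵇ K) + sumTo k term          ≡⟨ cong (_+ sumTo k term) (mismatch-not (s <ᵇ K) (t <ᵇ K)) ⟨
  mismatch (not (s <ᵇ K)) (not (t <ᵇ K)) + sumTo k term ≡⟨ cong (_+ sumTo k term) (cong₂ mismatch (last s<2K) (last t<2K)) ⟨
  term k + sumTo k term                              ≡⟨ +-comm (term k) (sumTo k term) ⟩
  codeDist K s t                                     ∎
  where
  open ≡-Reasoning
  term : ℕ → ℕ
  term j = mismatch (inArc K s j) (inArc K t j)
  last : ∀ {x} → x < K + K → inArc K x k ≡ not (x <ᵇ K)
  last {x} x<2K = trans (cong ((k <ᵇ x) ∧_) (<ᵇ-true x<2K)) (trans (∧-identityʳ (k <ᵇ x)) (<ᵇ-flip k x))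

codeDist-translate : ∀ K .{{_ : NonZero K}} c {D} → c + D ≤ K + K → codeDist K c (c + D) ≡ codeDist K 0 D
codeDist-translate K zero    _     = refl
codeDist-translate K (suc c) {D} c+D<2K =
  trans (codeDist-suc K (≤-trans (s≤s (m≤m+n c D)) c+D<2K) c+D<2K) (codeDist-translate K c (<⇒≤ c+D<2K))

codeDist-wrap : ∀ K s → codeDist K s (K + K) ≡ codeDist K s 0
codeDist-wrap K s = sumTo-cong K (λ j j<K → cong (mismatch (inArc K s j)) (outside j<K))
  where
  outside : ∀ {j} → j < K → inArc K (K + K) j ≡ false
  outside {j} j<K = trans (cong ((j <ᵇ K + K) ∧_) (<ᵇ-false (+-monoˡ-≤ K j<K))) (∧-zeroʳ (j <ᵇ K + K))

codeDist-reflect : ∀ K .{{_ : NonZero K}} {D} → D ≤ K + K → codeDist K 0 (K + K ∸ D) ≡ codeDist K 0 D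
codeDist-reflect K {D} D≤2K = begin
  codeDist K 0 (K + K ∸ D)         ≡⟨ codeDist-translate K D (≤-reflexive D+[2K∸D]≡2K) ⟨
  codeDist K D (D + (K + K ∸ D))   ≡⟨ cong (codeDist K D) D+[2K∸D]≡2K ⟩
  codeDist K D (K + K)             ≡⟨ codeDist-wrap K D ⟩
  codeDist K D 0                   ≡⟨ codeDist-comm K D 0 ⟩
  codeDist K 0 D                   ∎
  where
  open ≡-Reasoning
  D+[2K∸D]≡2K : D + (K + K ∸ D) ≡ K + K
  D+[2K∸D]≡2K = m+[n∸m]≡n D≤2K

≤-codeDist-from-0 : ∀ K {D} → D ≤ K → D ≤ codeDist K 0 D
≤-codeDist-from-0 K {D} D≤K = begin
  D                  ≡⟨ sumTo-ones D ones ⟨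
  sumTo D term       ≤⟨ sumTo-mono term D≤K ⟩
  codeDist K 0 D     ∎
  where
  open ≤-Reasoning
  term : ℕ → ℕ
  term j = mismatch false (inArc K D j)
  ones : ∀ j → j < D → term j ≡ 1
  ones j j<D rewrite <ᵇ-true j<D | <ᵇ-true (s≤s (≤-trans D≤K (m≤n+m K j))) = refl

circDist-≤-codeDist-from-0 : ∀ K .{{_ : NonZero K}} {D} → D ≤ K + K → circDist (K + K) 0 D ≤ codeDist K 0 D
circDist-≤-codeDist-from-0 K {D} D≤2K with ≤-total D K
... | inj₁ D≤K = ≤-trans (m⊓n≤m D (K + K ∸ D)) (≤-codeDist-from-0 K D≤K)
... | inj₂ K≤D = begin
  D ⊓ (K + K ∸ D)            ≤⟨ m⊓n≤n D (K + K ∸ D) ⟩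
  K + K ∸ D                  ≤⟨ ≤-codeDist-from-0 K 2K∸D≤K ⟩
  codeDist K 0 (K + K ∸ D)   ≡⟨ codeDist-reflect K D≤2K ⟩
  codeDist K 0 D             ∎
  where
  open ≤-Reasoning
  2K∸D≤K : K + K ∸ D ≤ K
  2K∸D≤K = ≤-trans (∸-monoʳ-≤ (K + K) K≤D) (≤-reflexive (m+n∸m≡n K K))

circDist-≤-codeDist-ordered : ∀ K .{{_ : NonZero K}} {s t} → s ≤ t → t ≤ K + K → circDist (K + K) s t ≤ codeDist K s t
circDist-≤-codeDist-ordered K {s} {t} s≤t t≤2K = begin
  circDist (K + K) s t                ≡⟨ circDist-≤ (K + K) s≤t ⟩
  circDist (K + K) 0 (t ∸ s)          ≤⟨ circDist-≤-codeDist-from-0 K (≤-trans (m∸n≤m t s) t≤2K) ⟩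
  codeDist K 0 (t ∸ s)                ≡⟨ codeDist-translate K s (≤-trans (≤-reflexive s+[t∸s]≡t) t≤2K) ⟨
  codeDist K s (s + (t ∸ s))          ≡⟨ cong (codeDist K s) s+[t∸s]≡t ⟩
  codeDist K s t                      ∎
  where
  open ≤-Reasoning
  s+[t∸s]≡t : s + (t ∸ s) ≡ t
  s+[t∸s]≡t = m+[n∸m]≡n s≤t

circDist-≤-codeDist : ∀ K {s t} → s ≤ K + K → t ≤ K + K → circDist (K + K) s t ≤ codeDist K s t
circDist-≤-codeDist zero {s} {t} _ _ =
  subst (_≤ codeDist 0 s t) (sym (trans (cong (∣ s - t ∣ ⊓_) (0∸n≡0 ∣ s - t ∣)) (⊓-zeroʳ ∣ s - t ∣))) z≤n
circDist-≤-codeDist K@(suc _) {s} {t} s≤2K t≤2K with ≤-total s t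
... | inj₁ s≤t = circDist-≤-codeDist-ordered K s≤t t≤2K
... | inj₂ t≤s = subst₂ _≤_ (circDist-comm (K + K) t s) (codeDist-comm K t s) (circDist-≤-codeDist-ordered K t≤s s≤2K)

PathOfWeight : {n : ℕ} → (Fin n → ℕ) → Fin n → Fin n → ℕ → Set
PathOfWeight w u v d = Σ (Walk u v) (λ p → IsPath p × weight w p ≡ d)

module _ {n : ℕ} where

  Step-flip : ∀ {e u v : Fin n} → Step e u v → Step e v u
  Step-flip (fwd e) = bwd e
  Step-flip (bwd e) = fwd e

  reverseOnto : ∀ {u v t : Fin n} → Walk u v → Walk u t → Walk v t
  reverseOnto nil          acc = acc
  reverseOnto (cons e s p) acc = reverseOnto p (cons e (Step-flip s) acc)

  reverseWalk : ∀ {u v : Fin n} → Walk u v → Walk v u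
  reverseWalk p = reverseOnto p nil

  weight-reverseOnto : ∀ (w : Fin n → ℕ) {u v t} (p : Walk u v) (acc : Walk u t) →
    weight w (reverseOnto p acc) ≡ weight w p + weight w acc
  weight-reverseOnto w nil          acc = refl
  weight-reverseOnto w (cons e s p) acc = begin
    weight w (reverseOnto p (cons e (Step-flip s) acc)) ≡⟨ weight-reverseOnto w p _ ⟩
    weight w p + (w e + weight w acc)                   ≡⟨ +-assoc (weight w p) (w e) _ ⟨
    weight w p + w e + weight w acc                     ≡⟨ cong (_+ weight w acc) (+-comm (weight w p) (w e)) ⟩
    w e + weight w p + weight w acc                     ∎
    where open ≡-Reasoning

  weight-reverseWalk : ∀ (w : Fin n → ℕ) {u v} (p : Walk u v) → weight w (reverseWalk p) ≡ weight w p
  weight-reverseWalk w p = trans (weight-reverseOnto w p nil) (+-identityʳ (weight w p))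

  vertices-∷ : ∀ {u v : Fin n} (p : Walk u v) → vertices p ≡ u ∷ drop 1 (vertices p)
  vertices-∷ nil          = refl
  vertices-∷ (cons e s p) = refl

  vertices-reverseOnto : ∀ {u v t : Fin n} (p : Walk u v) (acc : Walk u t) →
    vertices (reverseOnto p acc) ≡ reverseAcc (vertices acc) (drop 1 (vertices p))
  vertices-reverseOnto nil          acc = refl
  vertices-reverseOnto (cons e s p) acc =
    trans (vertices-reverseOnto p _) (cong (reverseAcc (vertices acc)) (sym (vertices-∷ p)))

  vertices-reverseWalk : ∀ {u v : Fin n} (p : Walk u v) → vertices (reverseWalk p) ≡ reverse (vertices p)
  vertices-reverseWalk p = trans (vertices-reverseOnto p nil) (cong reverse (sym (vertices-∷ p)))

  IsPath-reverseWalk : ∀ {u v : Fin n} (p : Walk u v) → IsPath p → IsPath (reverseWalk p)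
  IsPath-reverseWalk p unique = subst Unique (sym (vertices-reverseWalk p))
    (Permutationₛ.Unique-resp-↭ (setoid (Fin n)) (↭⇒↭ₛ (↭-sym (↭-reverse (vertices p)))) unique)

  PathOfWeight-sym : ∀ (w : Fin n → ℕ) {u v d} → PathOfWeight w u v d → PathOfWeight w v u d
  PathOfWeight-sym w (p , isPath , weight≡d) =
    reverseWalk p , IsPath-reverseWalk p isPath , trans (weight-reverseWalk w p) weight≡d

module Cycle (m : ℕ) (w : Fin (suc m) → ℕ) where

  N : ℕ
  N = suc m

  W : ℕ
  W = totalWeight w

  vertex : ℕ → Fin N
  vertex c = c mod N

  toℕ-vertex : ∀ c → toℕ (vertex c) ≡ c % N
  toℕ-vertex c = toℕ-fromℕ< (m%n<n c N)

  vertex-toℕ : ∀ i → vertex (toℕ i) ≡ i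
  vertex-toℕ i = toℕ-injective (trans (toℕ-vertex (toℕ i)) (m<n⇒m%n≡m (toℕ<n i)))

  vertex-cong : ∀ a b → a % N ≡ b % N → vertex a ≡ vertex b
  vertex-cong a b eq = toℕ-injective (trans (toℕ-vertex a) (trans eq (sym (toℕ-vertex b))))

  next-vertex : ∀ c → next (vertex c) ≡ vertex (suc c)
  next-vertex c = vertex-cong (suc (toℕ (vertex c))) (suc c) (begin
    suc (toℕ (vertex c)) % N         ≡⟨ cong (λ x → suc x % N) (toℕ-vertex c) ⟩
    (1 + c % N) % N                  ≡⟨ %-distribˡ-+ 1 (c % N) N ⟩
    (1 % N + c % N % N) % N          ≡⟨ cong (λ x → (1 % N + x) % N) (m%n%n≡m%n c N) ⟩
    (1 % N + c % N) % N              ≡⟨ %-distribˡ-+ 1 c N ⟨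
    suc c % N                        ∎)
    where open ≡-Reasoning

  vertex-+N : ∀ c → vertex (c + N) ≡ vertex c
  vertex-+N c = vertex-cong (c + N) c ([m+n]%n≡m%n c N)

  vertex-shift-≢ : ∀ c {e} → 0 < e → e < N → vertex c ≢ vertex (c + e)
  vertex-shift-≢ c 0<e e<N eq =
    m%n≢[m+o]%n N c 0<e e<N (trans (sym (toℕ-vertex c)) (trans (cong toℕ eq) (toℕ-vertex (c + _))))

  offset : ℕ → ℕ
  offset c = sumTo c (w ∘ vertex)

  pos : Fin N → ℕ
  pos i = offset (toℕ i)

  offset-N : offset N ≡ W
  offset-N = sym (sum-allFin N w (w ∘ vertex) (λ i → cong w (sym (vertex-toℕ i))))

  offset-+N : ∀ c → offset (c + N) ≡ offset c + W
  offset-+N zero    = offset-N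
  offset-+N (suc c) = begin
    offset (c + N) + w (vertex (c + N))  ≡⟨ cong₂ _+_ (offset-+N c) (cong w (vertex-+N c)) ⟩
    offset c + W + w (vertex c)          ≡⟨ +-assoc (offset c) W _ ⟩
    offset c + (W + w (vertex c))        ≡⟨ cong (offset c +_) (+-comm W _) ⟩
    offset c + (w (vertex c) + W)        ≡⟨ +-assoc (offset c) _ W ⟨
    offset (suc c) + W                   ∎
    where open ≡-Reasoning

  offset-mono : ∀ {a b} → a ≤ b → offset a ≤ offset b
  offset-mono = sumTo-mono (w ∘ vertex)

  offset≤W : ∀ {a} → a ≤ N → offset a ≤ W
  offset≤W {a} a≤N = subst (offset a ≤_) offset-N (offset-mono a≤N)

  pos≤W : ∀ i → pos i ≤ W
  pos≤W i = offset≤W (<⇒≤ (toℕ<n i))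

  pos-next : ∀ e → pos (next e) ≡ pos e + w e ⊎ (pos e + w e ≡ W × pos (next e) ≡ 0)
  pos-next e with m≤n⇒m<n∨m≡n (toℕ<n e)
  ... | inj₁ 1+e<N = inj₁ (begin
    offset (toℕ (vertex (suc (toℕ e))))  ≡⟨ cong offset (trans (toℕ-vertex (suc (toℕ e))) (m<n⇒m%n≡m 1+e<N)) ⟩
    pos e + w (vertex (toℕ e))           ≡⟨ cong (λ i → pos e + w i) (vertex-toℕ e) ⟩
    pos e + w e                          ∎)
    where open ≡-Reasoning
  ... | inj₂ 1+e≡N = inj₂ (pe+we≡W , cong offset (trans (toℕ-vertex (suc (toℕ e))) (trans (cong (_% N) 1+e≡N) (n%n≡0 N))))
    where
    open ≡-Reasoning
    pe+we≡W : pos e + w e ≡ W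
    pe+we≡W = begin
      pos e + w e                  ≡⟨ cong (λ i → pos e + w i) (vertex-toℕ e) ⟨
      offset (suc (toℕ e))         ≡⟨ cong offset 1+e≡N ⟩
      offset N                     ≡⟨ offset-N ⟩
      W                            ∎

  circDist-next : ∀ e {t} → t ≤ W → circDist W (pos (next e)) t ≡ circDist W (pos e + w e) t
  circDist-next e {t} t≤W with pos-next e
  ... | inj₁ unwrapped        = cong (λ s → circDist W s t) unwrapped
  ... | inj₂ (full , wrapped) = begin
    circDist W (pos (next e)) t   ≡⟨ cong (λ s → circDist W s t) wrapped ⟩
    circDist W 0 t                ≡⟨ circDist-end W t≤W ⟨
    circDist W W t                ≡⟨ cong (λ s → circDist W s t) full ⟨
    circDist W (pos e + w e) t    ∎
    where open ≡-Reasoning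

  circDist-edge : ∀ e {t} → t ≤ W →
    circDist W (pos e) t ≤ w e + circDist W (pos (next e)) t × circDist W (pos (next e)) t ≤ w e + circDist W (pos e) t
  circDist-edge e {t} t≤W rewrite circDist-next e t≤W =
    subst (λ d → circDist W (pos e) t ≤ d + circDist W (pos e + w e) t) (∣m-m+n∣≡n (pos e) (w e))
      (circDist-lipschitz W (pos e) (pos e + w e) t) ,
    subst (λ d → circDist W (pos e + w e) t ≤ d + circDist W (pos e) t) (trans (∣-∣-comm (pos e + w e) (pos e)) (∣m-m+n∣≡n (pos e) (w e)))
      (circDist-lipschitz W (pos e + w e) (pos e) t)

  circDist-≤-weight : ∀ {u v} (p : Walk u v) → circDist W (pos u) (pos v) ≤ weight w p
  circDist-≤-weight {u} nil = ≤-reflexive (circDist-refl W (pos u))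
  circDist-≤-weight {v = v} (cons e (fwd e) p) =
    ≤-trans (proj₁ (circDist-edge e (pos≤W v))) (+-monoʳ-≤ (w e) (circDist-≤-weight p))
  circDist-≤-weight {v = v} (cons e (bwd e) p) =
    ≤-trans (proj₂ (circDist-edge e (pos≤W v))) (+-monoʳ-≤ (w e) (circDist-≤-weight p))

  advance : ℕ → Fin N → Fin N
  advance zero    i = i
  advance (suc k) i = advance k (next i)

  forward : ∀ i k → Walk i (advance k i)
  forward i zero    = nil
  forward i (suc k) = cons i (fwd i) (forward (next i) k)

  advance-vertex : ∀ c k → advance k (vertex c) ≡ vertex (c + k)
  advance-vertex c zero    = cong vertex (sym (+-identityʳ c))
  advance-vertex c (suc k) = begin
    advance k (next (vertex c))   ≡⟨ cong (advance k) (next-vertex c) ⟩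
    advance k (vertex (suc c))    ≡⟨ advance-vertex (suc c) k ⟩
    vertex (suc c + k)            ≡⟨ cong vertex (+-suc c k) ⟨
    vertex (c + suc k)            ∎
    where open ≡-Reasoning

  weight-forward : ∀ c k → offset c + weight w (forward (vertex c) k) ≡ offset (c + k)
  weight-forward c zero    = trans (+-identityʳ (offset c)) (cong offset (sym (+-identityʳ c)))
  weight-forward c (suc k) = begin
    offset c + (w (vertex c) + weight w (forward (next (vertex c)) k))
      ≡⟨ cong (λ i → offset c + (w (vertex c) + weight w (forward i k))) (next-vertex c) ⟩
    offset c + (w (vertex c) + weight w (forward (vertex (suc c)) k))
      ≡⟨ +-assoc (offset c) (w (vertex c)) _ ⟨
    offset (suc c) + weight w (forward (vertex (suc c)) k)
      ≡⟨ weight-forward (suc c) k ⟩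
    offset (suc c + k)
      ≡⟨ cong offset (+-suc c k) ⟨
    offset (c + suc k) ∎
    where open ≡-Reasoning

  All-forward : ∀ (P : Fin N → Set) c k → (∀ j → j ≤ k → P (vertex (c + j))) → All P (vertices (forward (vertex c) k))
  All-forward P c zero    Pc+j = subst P (cong vertex (+-identityʳ c)) (Pc+j 0 z≤n) ∷ []
  All-forward P c (suc k) Pc+j = subst P (cong vertex (+-identityʳ c)) (Pc+j 0 z≤n) ∷
    subst (λ i → All P (vertices (forward i k))) (sym (next-vertex c))
      (All-forward P (suc c) k (λ j j≤k → subst P (cong vertex (+-suc c j)) (Pc+j (suc j) (s≤s j≤k))))

  IsPath-forward : ∀ c k → k < N → IsPath (forward (vertex c) k)
  IsPath-forward c zero    _   = [] ∷ []
  IsPath-forward c (suc k) k<N =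
    subst (λ i → All (vertex c ≢_) (vertices (forward i k))) (sym (next-vertex c))
      (All-forward (vertex c ≢_) (suc c) k (λ j j≤k → subst (λ x → vertex c ≢ vertex x) (+-suc c j)
        (vertex-shift-≢ c {suc j} z<s (<-≤-trans (s≤s (s≤s j≤k)) k<N)))) ∷
    subst (λ i → IsPath (forward i k)) (sym (next-vertex c)) (IsPath-forward (suc c) k (<⇒≤ k<N))

  forwardPath : ∀ {a b u v} → vertex a ≡ u → vertex b ≡ v → a ≤ b → b < a + N → PathOfWeight w u v (offset b ∸ offset a)
  forwardPath {a} {b} refl refl a≤b b<a+N =
    subst₂ (PathOfWeight w (vertex a)) endpoint weight≡ (forward (vertex a) k , IsPath-forward a k k<N , refl)
    where
    k : ℕ
    k = b ∸ a
    a+k≡b : a + k ≡ b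
    a+k≡b = m+[n∸m]≡n a≤b
    k<N : k < N
    k<N = +-cancelˡ-< a k N (subst (_< a + N) (sym a+k≡b) b<a+N)
    endpoint : advance k (vertex a) ≡ vertex b
    endpoint = trans (advance-vertex a k) (cong vertex a+k≡b)
    weight≡ : weight w (forward (vertex a) k) ≡ offset b ∸ offset a
    weight≡ = begin
      weight w (forward (vertex a) k)                              ≡⟨ m+n∸m≡n (offset a) _ ⟨
      offset a + weight w (forward (vertex a) k) ∸ offset a        ≡⟨ cong (_∸ offset a) (weight-forward a k) ⟩
      offset (a + k) ∸ offset a                                    ≡⟨ cong (λ c → offset c ∸ offset a) a+k≡b ⟩
      offset b ∸ offset a                                          ∎
      where open ≡-Reasoning

  clockwisePath : ∀ u v → toℕ u ≤ toℕ v → PathOfWeight w u v (pos v ∸ pos u)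
  clockwisePath u v u≤v = forwardPath (vertex-toℕ u) (vertex-toℕ v) u≤v (<-≤-trans (toℕ<n v) (m≤n+m N (toℕ u)))

  counterclockwisePath : ∀ u v → toℕ u < toℕ v → PathOfWeight w u v (W ∸ (pos v ∸ pos u))
  counterclockwisePath u v u<v = PathOfWeight-sym w (subst (PathOfWeight w v u) weight≡
    (forwardPath (vertex-toℕ v) (trans (vertex-+N (toℕ u)) (vertex-toℕ u))
      (≤-trans (<⇒≤ (toℕ<n v)) (m≤n+m N (toℕ u))) (+-monoˡ-< N u<v)))
    where
    weight≡ : offset (toℕ u + N) ∸ pos v ≡ W ∸ (pos v ∸ pos u)
    weight≡ = trans (cong (_∸ pos v) (offset-+N (toℕ u))) (m+o∸n≡o∸[n∸m] W (offset-mono (<⇒≤ u<v)))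

  shortestPath-< : ∀ u v → toℕ u < toℕ v → PathOfWeight w u v (circDist W (pos u) (pos v))
  shortestPath-< u v u<v =
    subst (PathOfWeight w u v) (sym (circDist-≤ W (offset-mono (<⇒≤ u<v)))) (shorterArc (⊓-sel D (W ∸ D)))
    where
    D : ℕ
    D = pos v ∸ pos u
    shorterArc : D ⊓ (W ∸ D) ≡ D ⊎ D ⊓ (W ∸ D) ≡ W ∸ D → PathOfWeight w u v (D ⊓ (W ∸ D))
    shorterArc (inj₁ min≡D)   = subst (PathOfWeight w u v) (sym min≡D) (clockwisePath u v (<⇒≤ u<v))
    shorterArc (inj₂ min≡W∸D) = subst (PathOfWeight w u v) (sym min≡W∸D) (counterclockwisePath u v u<v)

  shortestPath : ∀ u v → PathOfWeight w u v (circDist W (pos u) (pos v))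
  shortestPath u v with <-cmp (toℕ u) (toℕ v)
  ... | tri< u<v _ _ = shortestPath-< u v u<v
  ... | tri≈ _ u≡v _ = subst (λ v → PathOfWeight w u v (circDist W (pos u) (pos v))) (toℕ-injective u≡v)
                         (nil , [] ∷ [] , sym (circDist-refl W (pos u)))
  ... | tri> _ _ v<u = subst (PathOfWeight w u v) (circDist-comm W (pos v) (pos u)) (PathOfWeight-sym w (shortestPath-< v u v<u))

  isDist-circDist : ∀ u v → IsDist w u v (circDist W (pos u) (pos v))
  isDist-circDist u v = shortestPath u v , λ p _ → circDist-≤-weight p

  dist-≤-hamming : ∀ {M} (g : Fin N → Vec Bool M) → IsAddressing w M g → ∀ u v → circDist W (pos u) (pos v) ≤ hamming (g u) (g v)
  dist-≤-hamming g addr u v = addr u v _ (isDist-circDist u v)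

  K : ℕ
  K = ⌈ W /2⌉

  W≤K+K : W ≤ K + K
  W≤K+K = subst (_≤ K + K) (⌊n/2⌋+⌈n/2⌉≡n W) (+-monoˡ-≤ K (⌊n/2⌋≤⌈n/2⌉ W))

  arcCode-isAddressing : IsAddressing w K (arcCode K ∘ pos)
  arcCode-isAddressing u v d (_ , d≤paths) with shortestPath u v
  ... | p , isPath , weight≡ = begin
    d                                      ≤⟨ d≤paths p isPath ⟩
    weight w p                             ≡⟨ weight≡ ⟩
    circDist W (pos u) (pos v)             ≤⟨ circDist-monoˡ (pos u) (pos v) W≤K+K ⟩
    circDist (K + K) (pos u) (pos v)       ≤⟨ circDist-≤-codeDist K (≤-trans (pos≤W u) W≤K+K) (≤-trans (pos≤W v) W≤K+K) ⟩
    codeDist K (pos u) (pos v)             ≡⟨ hamming-arcCode K (pos u) (pos v) ⟨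
    hamming (arcCode K (pos u)) (arcCode K (pos v)) ∎
    where open ≤-Reasoning

  three-arcs : ∀ {M} (g : Fin N → Vec Bool M) → IsAddressing w M g → ∀ x y {X Y} → pos x ≡ X → pos y ≡ Y → X ≤ Y →
    X + X ≤ W → (Y ∸ X) + (Y ∸ X) ≤ W → (W ∸ Y) + (W ∸ Y) ≤ W → W ≤ M + M
  three-arcs {M} g addr x y refl refl x≤y short₁ short₂ short₃ = begin
    W                                                  ≡⟨ arcs-sum ⟨
    pos x + (pos y ∸ pos x) + (W ∸ pos y)              ≡⟨ cong₂ _+_ (cong₂ _+_ d₁ d₂) d₃ ⟨
    circDist W 0 (pos x) + circDist W (pos x) (pos y) + circDist W (pos y) 0
      ≤⟨ +-mono-≤ (+-mono-≤ (dist-≤-hamming g addr fzero x) (dist-≤-hamming g addr x y)) (dist-≤-hamming g addr y fzero) ⟩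
    hamming (g fzero) (g x) + hamming (g x) (g y) + hamming (g y) (g fzero)
      ≤⟨ hamming-cycle (g fzero) (g x) (g y) ⟩
    M + M                                              ∎
    where
    open ≤-Reasoning
    arcs-sum : pos x + (pos y ∸ pos x) + (W ∸ pos y) ≡ W
    arcs-sum = trans (cong (_+ (W ∸ pos y)) (m+[n∸m]≡n x≤y)) (m+[n∸m]≡n (pos≤W y))
    d₁ : circDist W 0 (pos x) ≡ pos x
    d₁ = circDist-short W z≤n short₁
    d₂ : circDist W (pos x) (pos y) ≡ pos y ∸ pos x
    d₂ = circDist-short W x≤y short₂
    d₃ : circDist W (pos y) 0 ≡ W ∸ pos y
    d₃ = trans (circDist-comm W (pos y) 0) (trans (sym (circDist-end W (pos≤W y)))
           (trans (circDist-comm W W (pos y)) (circDist-short W (pos≤W y) short₃)))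

  edge-short : (∀ i → w i ≤ W ∸ w i) → ∀ i → w i + w i ≤ W
  edge-short triangle i = m≤o∸n⇒m+n≤o (w i) (≤-trans (triangle i) (m∸n≤m W (w i))) (triangle i)

  W≤length+length : (∀ i → w i ≤ W ∸ w i) → ∀ {M} (g : Fin N → Vec Bool M) → IsAddressing w M g → W ≤ M + M
  -- x is the last vertex at clockwise offset at most W/2, and y the one after it (if any).
  W≤length+length triangle g addr with threshold-crossing (λ b → offset b + offset b) m z≤n
  ... | inj₁ short-m = three-arcs g addr x x pos-x pos-x ≤-refl short-m
          (subst (λ d → d + d ≤ W) (sym (n∸n≡0 (offset m))) z≤n)
          (subst (λ d → d + d ≤ W) (sym W∸offset-m) (edge-short triangle (vertex m)))
    where
    x : Fin N
    x = fromℕ m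
    pos-x : pos x ≡ offset m
    pos-x = cong offset (toℕ-fromℕ m)
    W∸offset-m : W ∸ offset m ≡ w (vertex m)
    W∸offset-m = trans (cong (_∸ offset m) (sym offset-N)) (m+n∸m≡n (offset m) _)
  ... | inj₂ (b , b<m , short-b , long-1+b) = three-arcs g addr x y pos-x pos-y (offset-mono (n≤1+n b)) short-b
          (subst (λ d → d + d ≤ W) (sym (m+n∸m≡n (offset b) _)) (edge-short triangle (vertex b)))
          (m∸n+m∸n≤m (offset≤W (m≤n⇒m≤1+n b<m)) (<⇒≤ long-1+b))
    where
    x y : Fin N
    x = fromℕ< (m<n⇒m<1+n b<m)
    y = fromℕ< (s≤s b<m)
    pos-x : pos x ≡ offset b
    pos-x = cong offset (toℕ-fromℕ< (m<n⇒m<1+n b<m))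
    pos-y : pos y ≡ offset (suc b)
    pos-y = cong offset (toℕ-fromℕ< (s≤s b<m))

theorem2 : (n : ℕ) → 3 ≤ n → (w : Fin n → ℕ)
    → ((i : Fin n) → 0 < w i)
    → ((i : Fin n) → w i ≤ totalWeight w ∸ w i)
    → IsMinAddressingLength w ⌈ totalWeight w /2⌉
theorem2 zero    ()
theorem2 (suc m) _ w _ triangle =
  (arcCode K ∘ pos , arcCode-isAddressing) ,
  λ M g addr → subst (K ≤_) (sym (n≡⌈n+n/2⌉ M)) (⌈n/2⌉-mono (W≤length+length triangle g addr))
  where open Cycle m w
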